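{- Let $r_1, r_2 \geq 2$ be integers. Suppose that for each $i \in \{1,2\}$, $$\chi\left(KG^{r_i}(n,k,s)\right) \geq \left\lceil \frac{n - r_i(k-s-1)}{r_i - 1} \right\rceil$$ holds for all integers $n, k, s$ with $n \geq r_i(k-1)+1$ and $k > s \geq 0$. Then $$\chi\left(KG^{r_1 r_2}(n,k,s)\right) \geq \left\lceil \frac{n - r_1 r_2(k-s-1)}{r_1 r_2 - 1} \right\rceil$$ holds for all integers $n, k, s$ with $n \geq r_1 r_2(k-1)+1$ and $k > s \geq 0$.
   Context: For a positive integer $n$, $[n]=\{1,\ldots,n\}$. The generalized Kneser hypergraph $KG^{r}(n,k,s)$ has as vertices all $k$-subsets of $[n]$, and as edges all sets $\{X_1,\ldots,X_r\}$ of $r$ distinct $k$-subsets of $[n]$ such that $|X_i \cap X_j| \leq s$ for all $i \neq j$. A proper $m$-coloring of a hypergraph is a map from its vertex set to $\{1,\ldots,m\}$ under which no edge is monochromatic; the chromatic number $\chi$ is the least $m$ for which a proper $m$-coloring exists. -}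

module Defs where

open import Data.Nat using (ℕ; zero; suc; _+_; _*_; _∸_; _≤_; _<_)
open import Data.Nat.DivMod using (_/_)
open import Data.Fin using (Fin)
open import Data.Fin.Subset using (Subset; _∩_; ∣_∣)
open import Data.Product using (_×_)
open import Relation.Binary.PropositionalEquality using (_≡_; _≢_)
open import Relation.Nullary using (¬_)

-- ceiling division ⌈ a / b ⌉ (b = 0 never occurs in use; returns 0 then)
⌈_/_⌉ : ℕ → ℕ → ℕ
⌈ a / zero ⌉ = 0
⌈ a / suc b ⌉ = (a + b) / suc b

IsEdge : (r n k s : ℕ) → (Fin r → Subset n) → Set
IsEdge r n k s X =
  (∀ i → ∣ X i ∣ ≡ k) ×
  (∀ i j → i ≢ j → X i ≢ X j) ×
  (∀ i j → i ≢ j → ∣ X i ∩ X j ∣ ≤ s)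

-- a proper m-coloring of KG^r(n,k,s); the coloring is given on all subsets of [n],
-- only its values on k-subsets matter
IsProperColoring : (r n k s m : ℕ) → (Subset n → Fin m) → Set
IsProperColoring r n k s m c =
  ∀ (X : Fin r → Subset n) → IsEdge r n k s X → ¬ (∀ i j → c (X i) ≡ c (X j))

ChiAtLeast : (r n k s t : ℕ) → Set
ChiAtLeast r n k s t =
  ∀ (m : ℕ) (c : Subset n → Fin m) → IsProperColoring r n k s m c → t ≤ m

KneserBound : ℕ → Set
KneserBound r =
  ∀ (n k s : ℕ) → r * (k ∸ 1) + 1 ≤ n → s < k →
  ChiAtLeast r n k s ⌈ (n ∸ r * (k ∸ s ∸ 1)) / (r ∸ 1) ⌉

module Submission where

-- Fix a proper m-colouring c of KG^{r₁r₂}(n,k,s) with m below the claimed bound, and pick an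
-- intermediate size K.  For each K-subset Y of [n], the colouring c restricted to the k-subsets
-- of Y is a colouring of KG^{r₂}(K,k,s) with too few colours, so Y contains a monochromatic
-- edge W_Y; colouring Y by the colour of W_Y gives an m-colouring of KG^{r₁}(n,K,s), again with
-- too few colours, so some r₁ pairwise s-intersecting K-sets Y₁,…,Y_{r₁} get the same colour.
-- The r₁r₂ sets W_{Yᵢ},ⱼ then form a monochromatic edge for c.  Choosing one W_Y for every Y is
-- a double-negation shift, which is constructive because there are finitely many subsets.
-- The arithmetic is the choice of K making both smaller hypergraphs admissible with m below
-- both bounds: K − 1 = max(r₂(k − 1), m(r₂ − 1) + r₂d) with d = k − s − 1 works, because
-- m(r₁r₂ − 1) + r₁r₂d = m(r₁ − 1) + r₁(m(r₂ − 1) + r₂d).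

open import Defs
open import Data.Bool using (_∧_)
open import Data.Fin using (Fin; zero; remQuot; combine)
open import Data.Fin.Properties using (combine-remQuot) renaming (_≟_ to _≟ᶠ_)
open import Data.Fin.Subset using (Subset; _∩_; ∣_∣; _⊆_; inside; outside) renaming (⊥ to ∅)
open import Data.Fin.Subset.Properties using (p⊆q⇒∣p∣≤∣q∣; ∩-idem; x∈p∩q⁺; x∈p∩q⁻)
open import Data.Nat using (ℕ; zero; suc; _+_; _*_; _∸_; _≤_; _<_; _⊓_; s≤s; s≤s⁻¹)
open import Data.Nat.Properties
open import Data.Nat.DivMod using (_/_; m<n*o⇒m/o<n; m*n/n≡m; /-monoˡ-≤)
open import Data.Nat.Tactic.RingSolver using (solve-∀)
open import Data.Product using (_×_; _,_; proj₁; proj₂; Σ; ∃-syntax; uncurry)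
open import Data.Sum using (_⊎_; inj₁; inj₂)
open import Data.Vec using ([]; _∷_; here; there)
open import Data.Vec.Properties using (∷-injective)
open import Function using (_∘_; _⇔_; mk⇔; Equivalence)
open import Relation.Binary.PropositionalEquality
open import Relation.Nullary using (¬_; yes; no; contradiction)

-- embed Y Z is the copy of Z ⊆ [∣Y∣] inside Y, so c ∘ embed Y colours KG^r(Y,k,s).
embed : ∀ {n} (Y : Subset n) → Subset ∣ Y ∣ → Subset n
embed [] [] = []
embed (outside ∷ Y) Z = outside ∷ embed Y Z
embed (inside ∷ Y) (b ∷ Z) = b ∷ embed Y Z

∣embed∣ : ∀ {n} (Y : Subset n) Z → ∣ embed Y Z ∣ ≡ ∣ Z ∣
∣embed∣ [] [] = refl
∣embed∣ (outside ∷ Y) Z = ∣embed∣ Y Z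
∣embed∣ (inside ∷ Y) (outside ∷ Z) = ∣embed∣ Y Z
∣embed∣ (inside ∷ Y) (inside ∷ Z) = cong suc (∣embed∣ Y Z)

embed-∩ : ∀ {n} (Y : Subset n) Z W → embed Y Z ∩ embed Y W ≡ embed Y (Z ∩ W)
embed-∩ [] [] [] = refl
embed-∩ (outside ∷ Y) Z W = cong (outside ∷_) (embed-∩ Y Z W)
embed-∩ (inside ∷ Y) (b ∷ Z) (c ∷ W) = cong (b ∧ c ∷_) (embed-∩ Y Z W)

embed-injective : ∀ {n} (Y : Subset n) Z W → embed Y Z ≡ embed Y W → Z ≡ W
embed-injective [] [] [] _ = refl
embed-injective (outside ∷ Y) Z W eq = embed-injective Y Z W (proj₂ (∷-injective eq))
embed-injective (inside ∷ Y) (b ∷ Z) (c ∷ W) eq =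
  cong₂ _∷_ (proj₁ (∷-injective eq)) (embed-injective Y Z W (proj₂ (∷-injective eq)))

embed⊆ : ∀ {n} (Y : Subset n) Z → embed Y Z ⊆ Y
embed⊆ (outside ∷ Y) Z (there x∈) = there (embed⊆ Y Z x∈)
embed⊆ (inside ∷ Y) (b ∷ Z) here = here
embed⊆ (inside ∷ Y) (b ∷ Z) (there x∈) = there (embed⊆ Y Z x∈)

∣embed∩embed∣≤∣∩∣ : ∀ {n} (Y Y′ : Subset n) Z Z′ → ∣ embed Y Z ∩ embed Y′ Z′ ∣ ≤ ∣ Y ∩ Y′ ∣
∣embed∩embed∣≤∣∩∣ Y Y′ Z Z′ = p⊆q⇒∣p∣≤∣q∣ λ x∈ →
  let x∈Z , x∈Z′ = x∈p∩q⁻ (embed Y Z) (embed Y′ Z′) x∈ in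
  x∈p∩q⁺ (embed⊆ Y Z x∈Z , embed⊆ Y′ Z′ x∈Z′)

∩-small⇒≢ : ∀ {n s k} {X Y : Subset n} → s < k → ∣ X ∣ ≡ k → ∣ X ∩ Y ∣ ≤ s → X ≢ Y
∩-small⇒≢ {s = s} {X = X} s<k ∣X∣≡k ∣X∩Y∣≤s refl =
  <⇒≱ s<k (subst (_≤ s) (trans (cong ∣_∣ (∩-idem X)) ∣X∣≡k) ∣X∩Y∣≤s)

remQuot-injective : ∀ {m} n {i j : Fin (m * n)} → remQuot {m} n i ≡ remQuot n j → i ≡ j
remQuot-injective {m} n {i} {j} eq = begin
  i                                 ≡⟨ combine-remQuot {m} n i ⟨
  uncurry combine (remQuot {m} n i) ≡⟨ cong (uncurry combine) eq ⟩
  uncurry combine (remQuot {m} n j) ≡⟨ combine-remQuot {m} n j ⟩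
  j                                 ∎
  where open ≡-Reasoning

assemble : ∀ {r₁ r₂ n} (Y : Fin r₁ → Subset n) → (∀ i → Fin r₂ → Subset ∣ Y i ∣) →
  Fin (r₁ * r₂) → Subset n
assemble {r₂ = r₂} Y W ℓ = let i , j = remQuot r₂ ℓ in embed (Y i) (W i j)

assemble-edge : ∀ {r₁ r₂ n k s K} {Y : Fin r₁ → Subset n} {W : ∀ i → Fin r₂ → Subset ∣ Y i ∣} →
  s < k → IsEdge r₁ n K s Y → (∀ i → IsEdge r₂ ∣ Y i ∣ k s (W i)) → IsEdge (r₁ * r₂) n k s (assemble Y W)
assemble-edge {r₁} {r₂} {n} {k} {s} {Y = Y} {W} s<k (_ , _ , Y-disjoint) W-edge =
  (λ ℓ → size (remQuot r₂ ℓ)) ,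
  (λ ℓ ℓ′ ℓ≢ℓ′ → ∩-small⇒≢ s<k (size _) (disjoint (ℓ≢ℓ′ ∘ remQuot-injective r₂))) ,
  (λ ℓ ℓ′ ℓ≢ℓ′ → disjoint (ℓ≢ℓ′ ∘ remQuot-injective r₂))
  where
  G : Fin r₁ × Fin r₂ → Subset n
  G (i , j) = embed (Y i) (W i j)

  size : ∀ p → ∣ G p ∣ ≡ k
  size (i , j) = trans (∣embed∣ (Y i) (W i j)) (proj₁ (W-edge i) j)

  disjoint : ∀ {p q} → p ≢ q → ∣ G p ∩ G q ∣ ≤ s
  disjoint {i , j} {i′ , j′} p≢q with i ≟ᶠ i′
  ... | yes refl = subst (_≤ s) (sym (trans (cong ∣_∣ (embed-∩ (Y i) (W i j) (W i j′))) (∣embed∣ (Y i) _)))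
                     (proj₂ (proj₂ (W-edge i)) j j′ (p≢q ∘ cong (i ,_)))
  ... | no i≢i′  = ≤-trans (∣embed∩embed∣≤∣∩∣ (Y i) (Y i′) _ _) (Y-disjoint i i′ i≢i′)

¬¬-pull-Subset : ∀ {n} {P : Subset n → Set} → (∀ Y → ¬ ¬ P Y) → ¬ ¬ (∀ Y → P Y)
¬¬-pull-Subset {zero} ¬¬P ¬∀P = ¬¬P [] λ P[] → ¬∀P λ { [] → P[] }
¬¬-pull-Subset {suc n} ¬¬P ¬∀P =
  ¬¬-pull-Subset (¬¬P ∘ (inside ∷_)) λ P-inside →
  ¬¬-pull-Subset (¬¬P ∘ (outside ∷_)) λ P-outside →
  ¬∀P λ { (inside ∷ Y) → P-inside Y ; (outside ∷ Y) → P-outside Y }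

IsMonochromaticEdge : (r n k s m : ℕ) → (Subset n → Fin m) → (Fin r → Subset n) → Set
IsMonochromaticEdge r n k s m c X = IsEdge r n k s X × (∀ i j → c (X i) ≡ c (X j))

χ-product : ∀ {r₁ r₂ n k s K t₁ t₂} → s < k →
  ChiAtLeast r₁ n K s t₁ → ChiAtLeast (suc r₂) K k s t₂ → ChiAtLeast (r₁ * suc r₂) n k s (t₁ ⊓ t₂)
χ-product {r₁} {r₂} {n} {k} {s} {K} {t₁} {t₂} s<k χ₁ χ₂ m c c-proper = ≮⇒≥ λ m<t →
  ¬¬-pull-Subset (inner (m<n⊓o⇒m<o t₁ t₂ m<t)) λ F →
  <⇒≱ (m<n⊓o⇒m<n t₁ t₂ m<t) (χ₁ m (outer F) (outer-proper F))
  where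
  -- W is chosen for every Y so that outer F below is total; it need only be an edge when ∣Y∣ ≡ K.
  InnerEdge : Subset n → Set
  InnerEdge Y = Σ (Fin (suc r₂) → Subset ∣ Y ∣) λ W →
    ∣ Y ∣ ≡ K → IsMonochromaticEdge (suc r₂) ∣ Y ∣ k s m (c ∘ embed Y) W

  inner : m < t₂ → ∀ Y → ¬ ¬ InnerEdge Y
  inner m<t₂ Y ¬inner with ∣ Y ∣ ≟ K
  ... | no ∣Y∣≢K  = ¬inner ((λ _ → ∅) , λ ∣Y∣≡K → contradiction ∣Y∣≡K ∣Y∣≢K)
  ... | yes ∣Y∣≡K = <⇒≱ m<t₂
    (subst (λ K → ChiAtLeast (suc r₂) K k s t₂) (sym ∣Y∣≡K) χ₂ m (c ∘ embed Y)
      λ W W-edge W-mono → ¬inner (W , λ _ → W-edge , W-mono))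

  outer : (∀ Y → InnerEdge Y) → Subset n → Fin m
  outer F Y = c (embed Y (proj₁ (F Y) zero))

  outer-proper : ∀ F → IsProperColoring r₁ n K s m (outer F)
  outer-proper F Y Y-edge Y-mono =
    c-proper (assemble Y W) (assemble-edge s<k Y-edge (proj₁ ∘ W-mono-edge)) mono
    where
    W : ∀ i → Fin (suc r₂) → Subset ∣ Y i ∣
    W i = proj₁ (F (Y i))

    W-mono-edge : ∀ i → IsMonochromaticEdge (suc r₂) ∣ Y i ∣ k s m (c ∘ embed (Y i)) (W i)
    W-mono-edge i = proj₂ (F (Y i)) (proj₁ Y-edge i)

    colour : ∀ ℓ → c (assemble Y W ℓ) ≡ outer F (Y (proj₁ (remQuot (suc r₂) ℓ)))
    colour ℓ = proj₂ (W-mono-edge _) _ zero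

    mono : ∀ ℓ ℓ′ → c (assemble Y W ℓ) ≡ c (assemble Y W ℓ′)
    mono ℓ ℓ′ = trans (colour ℓ) (trans (Y-mono _ _) (sym (colour ℓ′)))

⌈/⌉≤ : ∀ a b m → a ≤ m * suc b → ⌈ a / suc b ⌉ ≤ m
⌈/⌉≤ a b m a≤ = s≤s⁻¹ (m<n*o⇒m/o<n (begin-strict
  a + b             ≤⟨ +-monoˡ-≤ b a≤ ⟩
  m * suc b + b     <⟨ +-monoʳ-< (m * suc b) (n<1+n b) ⟩
  m * suc b + suc b ≡⟨ +-comm (m * suc b) (suc b) ⟩
  suc m * suc b     ∎))
  where open ≤-Reasoning

<⌈/⌉ : ∀ a b m → m * suc b < a → m < ⌈ a / suc b ⌉
<⌈/⌉ a b m m*b<a = begin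
  suc m                         ≡⟨ m*n/n≡m (suc m) (suc b) ⟨
  (suc b + m * suc b) / suc b   ≡⟨ cong (_/ suc b) (+-comm (suc b) (m * suc b)) ⟩
  (m * suc b + suc b) / suc b   ≡⟨ cong (_/ suc b) (+-suc (m * suc b) b) ⟩
  suc (m * suc b + b) / suc b   ≤⟨ /-monoˡ-≤ (suc b) (+-monoˡ-≤ b m*b<a) ⟩
  (a + b) / suc b               ∎
  where open ≤-Reasoning

<⌈/⌉⇔*< : ∀ a b m → m < ⌈ a / suc b ⌉ ⇔ m * suc b < a
<⌈/⌉⇔*< a b m = mk⇔ (λ m<⌈⌉ → ≰⇒> λ a≤ → <⇒≱ m<⌈⌉ (⌈/⌉≤ a b m a≤)) (<⌈/⌉ a b m)

threshold : (r m d : ℕ) → ℕ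
threshold r m d = m * (r ∸ 1) + r * d

BelowBound : (r n k s m : ℕ) → Set
BelowBound r n k s m = threshold r m (k ∸ s ∸ 1) < n

Admissible : (r n k s : ℕ) → Set
Admissible r n k s = r * (k ∸ 1) + 1 ≤ n × s < k

threshold-mono-≤ : ∀ r {m m′ d d′} → m ≤ m′ → d ≤ d′ → threshold r m d ≤ threshold r m′ d′
threshold-mono-≤ r m≤m′ d≤d′ = +-mono-≤ (*-monoˡ-≤ (r ∸ 1) m≤m′) (*-monoʳ-≤ r d≤d′)

threshold-* : ∀ p₁ p₂ m d →
  threshold (suc p₁ * suc p₂) m d ≡ threshold (suc p₁) m (threshold (suc p₂) m d)
threshold-* p₁ p₂ m d = identity p₁ p₂ m d
  where
  identity : ∀ a b m d → m * (b + a * suc b) + suc a * suc b * d ≡ m * a + suc a * (m * b + suc b * d)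
  identity = solve-∀

s+threshold : ∀ p s d → s + threshold (suc p) s d ≡ suc p * (s + d)
s+threshold p s d = identity p s d
  where
  identity : ∀ p s d → s + (s * p + suc p * d) ≡ suc p * (s + d)
  identity = solve-∀

BelowBound⇔<⌈⌉ : ∀ q n k s m →
  BelowBound (suc (suc q)) n k s m ⇔ m < ⌈ (n ∸ suc (suc q) * (k ∸ s ∸ 1)) / (suc (suc q) ∸ 1) ⌉
BelowBound⇔<⌈⌉ q n k s m = mk⇔
  (λ below → Equivalence.from (<⌈/⌉⇔*< _ q m) (m+n≤o⇒m≤o∸n (suc (m * suc q)) below))
  (λ m<⌈⌉ → let m*r<n∸x = Equivalence.to (<⌈/⌉⇔*< _ q m) m<⌈⌉ in
    m≤o∸n⇒m+n≤o (suc (m * suc q)) (m<n∸o⇒o≤n m*r<n∸x) m*r<n∸x)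
  where
  m<n∸o⇒o≤n : ∀ {a b c} → a < b ∸ c → c ≤ b
  m<n∸o⇒o≤n {a} {b} {c} a<b∸c = <⇒≤ (m∸n≢0⇒n<m λ b∸c≡0 → contradiction (subst (a <_) b∸c≡0 a<b∸c) λ ())

suc[m]∸n∸1≡m∸n : ∀ m n → suc m ∸ n ∸ 1 ≡ m ∸ n
suc[m]∸n∸1≡m∸n m n = trans (∸-+-assoc (suc m) n 1) (cong (suc m ∸_) (+-comm n 1))

suc[s+d]∸s∸1≡d : ∀ s d → suc (s + d) ∸ s ∸ 1 ≡ d
suc[s+d]∸s∸1≡d s d = trans (suc[m]∸n∸1≡m∸n (s + d) s) (m+n∸m≡n s d)

<⇒+1≤ : ∀ {m n} → m < n → m + 1 ≤ n
<⇒+1≤ {m} {n} = subst (_≤ n) (+-comm 1 m)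

threshold[r₂[s+d]∸s]<n : ∀ p₁ p₂ s d m n →
  suc p₁ * suc p₂ * (s + d) < n → threshold (suc p₁ * suc p₂) m d < n →
  threshold (suc p₁) m (suc p₂ * (s + d) ∸ s) < n
threshold[r₂[s+d]∸s]<n p₁ p₂ s d m n large below
  rewrite sym (s+threshold p₂ s d) | m+n∸m≡n s (threshold (suc p₂) s d) with ≤-total m s
... | inj₁ m≤s = begin-strict
  threshold (suc p₁) m (threshold (suc p₂) s d)
    ≤⟨ threshold-mono-≤ (suc p₁) m≤s (≤-refl {threshold (suc p₂) s d}) ⟩
  threshold (suc p₁) s (threshold (suc p₂) s d)      ≡⟨ threshold-* p₁ p₂ s d ⟨
  threshold (suc p₁ * suc p₂) s d                    ≤⟨ m≤n+m _ s ⟩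
  s + threshold (suc p₁ * suc p₂) s d                ≡⟨ s+threshold (p₂ + p₁ * suc p₂) s d ⟩
  suc p₁ * suc p₂ * (s + d)                          <⟨ large ⟩
  n                                                  ∎
  where open ≤-Reasoning
... | inj₂ s≤m = begin-strict
  threshold (suc p₁) m (threshold (suc p₂) s d)
    ≤⟨ threshold-mono-≤ (suc p₁) (≤-refl {m}) (threshold-mono-≤ (suc p₂) s≤m (≤-refl {d})) ⟩
  threshold (suc p₁) m (threshold (suc p₂) m d)      ≡⟨ threshold-* p₁ p₂ m d ⟨
  threshold (suc p₁ * suc p₂) m d                    <⟨ below ⟩
  n                                                  ∎
  where open ≤-Reasoning

sizeConditions : ∀ p₁ p₂ {n s d m} L →
  suc p₂ * (s + d) ≤ L → threshold (suc p₂) m d ≤ L →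
  suc p₁ * L < n → threshold (suc p₁) m (L ∸ s) < n →
  Admissible (suc p₂) (suc L) (suc (s + d)) s × BelowBound (suc p₂) (suc L) (suc (s + d)) s m ×
  Admissible (suc p₁) n (suc L) s × BelowBound (suc p₁) n (suc L) s m
sizeConditions p₁ p₂ {n} {s} {d} {m} L A≤L B≤L r₁L<n below₁ =
  (<⇒+1≤ (s≤s A≤L) , s≤s (m≤m+n s d)) ,
  subst (λ x → threshold (suc p₂) m x < suc L) (sym (suc[s+d]∸s∸1≡d s d)) (s≤s B≤L) ,
  (<⇒+1≤ r₁L<n , s≤s s≤L) ,
  subst (λ x → threshold (suc p₁) m x < n) (sym (suc[m]∸n∸1≡m∸n L s)) below₁
  where
  s≤L : s ≤ L
  s≤L = ≤-trans (m≤m+n s d) (≤-trans (m≤n*m (s + d) (suc p₂)) A≤L)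

intermediateSize : ∀ p₁ p₂ {n k s m} →
  Admissible (suc p₁ * suc p₂) n k s → BelowBound (suc p₁ * suc p₂) n k s m →
  ∃[ K ] (Admissible (suc p₂) K k s × BelowBound (suc p₂) K k s m ×
          Admissible (suc p₁) n K s × BelowBound (suc p₁) n K s m)
intermediateSize p₁ p₂ {n} {s = s} {m} (n-large , s<k) below
  with d , refl ← m≤n⇒∃[o]m+o≡n s<k = larger (≤-total A B)
  where
  A B : ℕ
  A = suc p₂ * (s + d)
  B = threshold (suc p₂) m d

  below-d : threshold (suc p₁ * suc p₂) m d < n
  below-d = subst (λ x → threshold (suc p₁ * suc p₂) m x < n) (suc[s+d]∸s∸1≡d s d) below

  below′ : threshold (suc p₁) m B < n
  below′ = subst (_< n) (threshold-* p₁ p₂ m d) below-d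

  large : suc p₁ * suc p₂ * (s + d) < n
  large = subst (_≤ n) (+-comm _ 1) n-large

  larger : A ≤ B ⊎ B ≤ A →
    ∃[ K ] (Admissible (suc p₂) K (suc (s + d)) s × BelowBound (suc p₂) K (suc (s + d)) s m ×
            Admissible (suc p₁) n K s × BelowBound (suc p₁) n K s m)
  larger (inj₁ A≤B) = suc B , sizeConditions p₁ p₂ {n} {s} {d} {m} B A≤B ≤-refl
    (≤-<-trans (m≤n+m (suc p₁ * B) (m * p₁)) below′)
    (≤-<-trans (threshold-mono-≤ (suc p₁) (≤-refl {m}) (m∸n≤m B s)) below′)
  larger (inj₂ B≤A) = suc A , sizeConditions p₁ p₂ {n} {s} {d} {m} A ≤-refl B≤A
    (subst (_< n) (*-assoc (suc p₁) (suc p₂) (s + d)) large)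
    (threshold[r₂[s+d]∸s]<n p₁ p₂ s d m n large below-d)

mainTheorem2 : (r₁ r₂ : ℕ) → 2 ≤ r₁ → 2 ≤ r₂ →
    KneserBound r₁ → KneserBound r₂ → KneserBound (r₁ * r₂)
mainTheorem2 (suc (suc q₁)) (suc (suc q₂)) _ _ bound₁ bound₂ n k s n-large s<k m c c-proper =
  ≮⇒≥ λ m<bound →
    let K , (K-large , _) , below₂ , (n-large′ , s<K) , below₁ =
          intermediateSize (suc q₁) (suc q₂) {n} {k} {s} {m} (n-large , s<k)
            (Equivalence.from (BelowBound⇔<⌈⌉ (q₂ + suc q₁ * suc (suc q₂)) n k s m) m<bound)
    in <⇒≱ (⊓-glb (Equivalence.to (BelowBound⇔<⌈⌉ q₁ n K s m) below₁)
                  (Equivalence.to (BelowBound⇔<⌈⌉ q₂ K k s m) below₂))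
           (χ-product s<k (bound₁ n K s n-large′ s<K) (bound₂ K k s K-large s<k) m c c-proper)
mainTheorem2 (suc zero) _ (s≤s ()) _ _ _
mainTheorem2 (suc (suc _)) (suc zero) _ (s≤s ()) _ _
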